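{- Let $k\ge1$ and let $G'$ be a subgraph of $G_d$ which, with the inherited edge coloring, is $k$-flat. Then every walk in $G'$ of length at most $2k+1$ has a unique edge of largest color.
   Context: Let $d\ge1$, $b=\lfloor d/2\rfloor$. $G_d=(A,B,E)$ is the bipartite graph with $A=\{x\in\{0,1\}^d:\sum x_i=b\}$, $B=\{x\in\{0,1\}^d:\sum x_i=b+1\}$ and $(x,y)\in E$ for $x\in A,y\in B$ differing in exactly one position, the edge colored by that position in $\{1,\dots,d\}$. A walk of length $m$ is $v_0,\dots,v_m$ with consecutive vertices adjacent and $v_{i-2}\ne v_i$; its coloring is $(c_1,\dots,c_m)$, $c_i$ the color of $v_{i-1}v_i$. The height function of $W$ is $h_W(1)=0$, $h_W(i+1)=h_W(i)\pm1$ according to whether $c_{i+1}>c_i$ or $c_{i+1}<c_i$. A properly edge colored graph is $k$-flat if for every walk $W$ of length $m\ge2$ with $h_W(i)<0$ for all $2\le i\le m$: if $m\le 2k+1$ or $h_W(i)\ge-k$ for all $i$, then $c_1>c_m$. -}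

module Defs where

open import Data.Nat as ℕ using (ℕ; zero; suc; _+_; _*_; ⌊_/2⌋)
open import Data.Bool using (Bool; true; false)
open import Data.Vec using (Vec; []; _∷_; lookup)
open import Data.Fin as Fin using (Fin)
open import Data.Integer as ℤ using (ℤ; 0ℤ; 1ℤ; -1ℤ)
open import Data.Product using (_×_; ∃; ∃-syntax)
open import Data.Sum using (_⊎_)
open import Relation.Binary.PropositionalEquality using (_≡_; _≢_)
open import Relation.Nullary using (yes; no)

Vert : ℕ → Set
Vert d = Vec Bool d

weight : ∀ {d} → Vert d → ℕ
weight [] = 0
weight (true ∷ x) = suc (weight x)
weight (false ∷ x) = weight x

InA : ∀ {d} → Vert d → Set
InA {d} x = weight x ≡ ⌊ d /2⌋

InB : ∀ {d} → Vert d → Set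
InB {d} x = weight x ≡ suc ⌊ d /2⌋

-- x and y differ in exactly one position, namely position i.
-- (Colors/positions {1,…,d} are represented by Fin d, same order.)
DiffAt : ∀ {d} → Vert d → Vert d → Fin d → Set
DiffAt x y i = ((j : Fin _) → j ≢ i → lookup x j ≡ lookup y j) × (lookup x i ≢ lookup y i)

GEdge : ∀ {d} → Vert d → Vert d → Set
GEdge x y = InA x × InB y × ∃[ i ] DiffAt x y i

-- A subgraph G' of G_d: a vertex set and an edge set (edges stored as
-- ordered pairs (a , b) with a ∈ A, b ∈ B), edges being edges of G_d with
-- both endpoints in the vertex set.
record Subgraph (d : ℕ) : Set₁ where
  field
    Vtx      : Vert d → Set
    Edg      : Vert d → Vert d → Set
    vtx-in-G : ∀ {x} → Vtx x → InA x ⊎ InB x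
    edg-in-G : ∀ {x y} → Edg x y → GEdge x y
    edg-ends : ∀ {x y} → Edg x y → Vtx x × Vtx y

Adj : ∀ {d} → Subgraph d → Vert d → Vert d → Set
Adj G' u v = Subgraph.Edg G' u v ⊎ Subgraph.Edg G' v u

-- A walk of length m in G': vertices v 0, …, v m and colors c 1, …, c m,
-- where c (i+1) is the color (= the unique differing position) of the edge
-- v i — v (i+1).  Values of v, c outside these ranges are irrelevant.
record IsWalk {d} (G' : Subgraph d) (m : ℕ) (v : ℕ → Vert d) (c : ℕ → Fin d) : Set where
  field
    step    : ∀ i → suc i ℕ.≤ m → Adj G' (v i) (v (suc i)) × DiffAt (v i) (v (suc i)) (c (suc i))
    nonback : ∀ i → suc (suc i) ℕ.≤ m → v i ≢ v (suc (suc i))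

-- ±1 step of the height function: +1 if the next color is larger, −1 if
-- smaller (equal consecutive colors never occur in a walk).
hstep : ∀ {d} → Fin d → Fin d → ℤ
hstep a b with a Fin.<? b
... | yes _ = 1ℤ
... | no _  = -1ℤ

-- Height function h_W(i), meaningful for 1 ≤ i ≤ m: h(1) = 0,
-- h(i+1) = h(i) ± 1.  (h 0 is a junk value.)
height : ∀ {d} → (ℕ → Fin d) → ℕ → ℤ
height c zero = 0ℤ
height c (suc zero) = 0ℤ
height c (suc (suc n)) = height c (suc n) ℤ.+ hstep (c (suc n)) (c (suc (suc n)))

Flat : ∀ {d} → ℕ → Subgraph d → Set
Flat k G' =
  ∀ m v c → IsWalk G' m v c → 2 ℕ.≤ m →
  (∀ i → 2 ℕ.≤ i → i ℕ.≤ m → height c i ℤ.< 0ℤ) →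
  (m ℕ.≤ 2 * k + 1 ⊎ (∀ i → 1 ℕ.≤ i → i ℕ.≤ m → ℤ.- (ℤ.+ k) ℤ.≤ height c i)) →
  c m Fin.< c 1

module Submission where

-- Let i be the last position of a largest colour j, and suppose j also
-- occurs at an earlier position; let p < q be two consecutive occurrences.
-- Compare the heights h(p) and h(q):
--  * h(q) < h(p): after the last maximum r of h on [p, q] the heights stay
--    strictly below h(r), so flatness of the segment from edge r to edge q
--    gives c(q) < c(r), i.e. a colour larger than j ("descent").
--  * h(q) > h(p): the same argument on the reversed walk ("ascent").
--  * h(q) = h(p): then q − p is even, so the edges p and q start on the
--    same side of the bipartition and hence flip coordinate j in the same
--    direction; but j is not flipped in between, a contradiction.

module FlatWalks where
  open import Defs
  open import Data.Nat using (ℕ; zero; suc; _+_; _*_; _∸_; _≤_; _<_; z≤n; s≤s; ⌊_/2⌋)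
  import Data.Nat.Properties as ℕP
  open import Data.Fin as Fin using (Fin)
  import Data.Fin.Properties as FinP
  open import Data.Integer as ℤ using (ℤ; 0ℤ; 1ℤ; -1ℤ; _-_)
  import Data.Integer.Properties as ℤP
  open import Data.Integer.Tactic.RingSolver using (solve-∀)
  open import Data.Bool using (true; false)
  open import Data.Bool.Properties using (¬-not)
  open import Data.Vec using (_∷_; lookup)
  open import Data.Vec.Properties using (tabulate∘lookup; tabulate-cong)
  open import Data.Product using (_×_; _,_; proj₁; proj₂; ∃-syntax)
  open import Data.Sum using (_⊎_; inj₁; inj₂; swap)
  open import Data.Empty using (⊥)
  open import Relation.Nullary using (¬_; yes; no; contradiction; _×-dec_)
  open import Relation.Unary using (Decidable)
  open import Relation.Binary using (Rel; IsStrictTotalOrder; tri<; tri≈; tri>)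
  open import Relation.Binary.PropositionalEquality
  open import Function using (_∘_)

  ≤-suc-cases : ∀ {i q} → i ≤ suc q → i ≤ q ⊎ i ≡ suc q
  ≤-suc-cases i≤sq with ℕP.m≤n⇒m<n∨m≡n i≤sq
  ... | inj₁ i<sq = inj₁ (ℕP.≤-pred i<sq)
  ... | inj₂ i≡sq = inj₂ i≡sq

  reflect-< : ∀ {n s t} → t ≤ n → s < n ∸ t → t < n ∸ s
  reflect-< {n} {s} {t} t≤n s<n∸t =
    subst (_< n ∸ s) (ℕP.m∸[m∸n]≡n t≤n) (ℕP.∸-monoʳ-< s<n∸t (ℕP.m∸n≤m n t))

  reflect-≤ : ∀ {n s t} → t ≤ n → n ∸ t ≤ s → n ∸ s ≤ t
  reflect-≤ {n} {s} {t} t≤n n∸t≤s =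
    subst (n ∸ s ≤_) (ℕP.m∸[m∸n]≡n t≤n) (ℕP.∸-monoʳ-≤ n n∸t≤s)

  module _ {ℓ} {P : ℕ → Set ℓ} (P? : Decidable P) where

    least-below : ∀ b → (∀ u → u < b → ¬ P u) ⊎ ∃[ q ] (q < b × P q × (∀ u → u < q → ¬ P u))
    least-below zero = inj₁ (λ _ ())
    least-below (suc b) with least-below b
    ... | inj₂ (q , q<b , Pq , earlier) = inj₂ (q , ℕP.m≤n⇒m≤1+n q<b , Pq , earlier)
    ... | inj₁ none with P? b
    ...   | yes Pb = inj₂ (b , ℕP.≤-refl , Pb , none)
    ...   | no ¬Pb = inj₁ none′
      where
      none′ : ∀ u → u < suc b → ¬ P u
      none′ u u<sb with ≤-suc-cases u<sb
      ... | inj₁ u<b = none u u<b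
      ... | inj₂ refl = ¬Pb

    least-witness : ∀ {n} → P n → ∃[ q ] (P q × q ≤ n × (∀ u → u < q → ¬ P u))
    least-witness {n} Pn with least-below (suc n)
    ... | inj₁ none = contradiction Pn (none n ℕP.≤-refl)
    ... | inj₂ (q , q<sn , Pq , earlier) = q , Pq , ℕP.≤-pred q<sn , earlier

  module _ {a ℓ} {A : Set a} {_≺_ : Rel A ℓ} (order : IsStrictTotalOrder _≡_ _≺_) where
    open IsStrictTotalOrder order using (compare; irrefl; asym; _<?_) renaming (trans to ≺-trans)

    private
      ≮-≺-trans : ∀ {x y z} → ¬ (y ≺ x) → y ≺ z → x ≺ z
      ≮-≺-trans {x} {y} y≮x y≺z with compare x y
      ... | tri< x≺y _ _ = ≺-trans x≺y y≺z
      ... | tri≈ _ refl _ = y≺z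
      ... | tri> _ _ y≺x = contradiction y≺x y≮x

    last-argmax : (f : ℕ → A) (p q : ℕ) → p ≤ q →
      ∃[ r ] (p ≤ r × r ≤ q
             × (∀ i → p ≤ i → i ≤ q → ¬ (f r ≺ f i))
             × (∀ i → r < i → i ≤ q → f i ≺ f r))
    last-argmax f p q p≤q with ℕP.m≤n⇒m<n∨m≡n p≤q
    ... | inj₂ refl = p , ℕP.≤-refl , ℕP.≤-refl , not-above , λ i p<i i≤p → contradiction i≤p (ℕP.<⇒≱ p<i)
      where
      not-above : ∀ i → p ≤ i → i ≤ p → ¬ (f p ≺ f i)
      not-above i p≤i i≤p rewrite ℕP.≤-antisym i≤p p≤i = irrefl refl
    last-argmax f p (suc q) _ | inj₁ p<sq with last-argmax f p q (ℕP.≤-pred p<sq)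
    ... | r , p≤r , r≤q , not-above , below with f (suc q) <? f r
    ...   | yes new≺r = r , p≤r , ℕP.m≤n⇒m≤1+n r≤q , not-above′ , below′
      where
      not-above′ : ∀ i → p ≤ i → i ≤ suc q → ¬ (f r ≺ f i)
      not-above′ i p≤i i≤sq with ≤-suc-cases i≤sq
      ... | inj₁ i≤q = not-above i p≤i i≤q
      ... | inj₂ refl = asym new≺r
      below′ : ∀ i → r < i → i ≤ suc q → f i ≺ f r
      below′ i r<i i≤sq with ≤-suc-cases i≤sq
      ... | inj₁ i≤q = below i r<i i≤q
      ... | inj₂ refl = new≺r
    ...   | no new⊀r = suc q , ℕP.<⇒≤ p<sq , ℕP.≤-refl , not-above′ , λ i sq<i i≤sq → contradiction i≤sq (ℕP.<⇒≱ sq<i)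
      where
      not-above′ : ∀ i → p ≤ i → i ≤ suc q → ¬ (f (suc q) ≺ f i)
      not-above′ i p≤i i≤sq with ≤-suc-cases i≤sq
      ... | inj₁ i≤q = λ new≺i → not-above i p≤i i≤q (≮-≺-trans new⊀r new≺i)
      ... | inj₂ refl = irrefl refl

  module _ {n : ℕ} where

    vert-ext : {x y : Vert n} → (∀ i → lookup x i ≡ lookup y i) → x ≡ y
    vert-ext {x} {y} same =
      trans (sym (tabulate∘lookup x)) (trans (tabulate-cong same) (tabulate∘lookup y))

    DiffAt-sym : ∀ {x y : Vert n} {i} → DiffAt x y i → DiffAt y x i
    DiffAt-sym (agree , differ) = (λ j j≢i → sym (agree j j≢i)) , (λ eq → differ (sym eq))

    -- Flipping the same coordinate twice leads back to the start; this is
    -- why consecutive edges of a walk have distinct colours.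
    DiffAt-twice : ∀ {x y z : Vert n} {i} → DiffAt x y i → DiffAt y z i → x ≡ z
    DiffAt-twice {x} {y} {z} {i} (agree₁ , differ₁) (agree₂ , differ₂) = vert-ext same
      where
      same : ∀ j → lookup x j ≡ lookup z j
      same j with j Fin.≟ i
      ... | yes refl = trans (¬-not differ₁) (sym (¬-not (λ eq → differ₂ (sym eq))))
      ... | no j≢i = trans (agree₁ j j≢i) (agree₂ j j≢i)

  flip-weight : ∀ {n} (x y : Vert n) i → DiffAt x y i →
    (lookup x i ≡ false × weight y ≡ suc (weight x)) ⊎ (lookup x i ≡ true × weight x ≡ suc (weight y))
  flip-weight (a ∷ x) (b ∷ y) Fin.zero (agree , differ)
    with vert-ext {x = x} {y} (λ j → agree (Fin.suc j) λ ())
  flip-weight (false ∷ x) (false ∷ x) Fin.zero (_ , differ) | refl = contradiction refl differ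
  flip-weight (false ∷ x) (true ∷ x) Fin.zero _ | refl = inj₁ (refl , refl)
  flip-weight (true ∷ x) (false ∷ x) Fin.zero _ | refl = inj₂ (refl , refl)
  flip-weight (true ∷ x) (true ∷ x) Fin.zero (_ , differ) | refl = contradiction refl differ
  flip-weight (a ∷ x) (b ∷ y) (Fin.suc i) (agree , differ)
    with agree Fin.zero (λ ()) | flip-weight x y i ((λ j j≢i → agree (Fin.suc j) (λ eq → j≢i (FinP.suc-injective eq))) , differ)
  ... | refl | r with a
  ...   | false = r
  ...   | true with r
  ...     | inj₁ (bit , w) = inj₁ (bit , cong suc w)
  ...     | inj₂ (bit , w) = inj₂ (bit , cong suc w)

  -- Walks in G_d

  module WalkInCube {d} {G' : Subgraph d} {m} {v : ℕ → Vert d} {c : ℕ → Fin d}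
                    (W : IsWalk G' m v c) where
    open IsWalk W

    -- Consecutive edges have distinct colours, since a walk never backtracks.
    colours-differ : ∀ x → 1 ≤ x → suc x ≤ m → c x ≢ c (suc x)
    colours-differ (suc t) _ st<m same =
      nonback t st<m (DiffAt-twice {y = v (suc t)} (proj₂ (step t (ℕP.<⇒≤ st<m)))
        (subst (DiffAt (v (suc t)) (v (suc (suc t)))) (sym same) (proj₂ (step (suc t) st<m))))

    b : ℕ
    b = ⌊ d /2⌋

    w : ℕ → ℕ
    w t = weight (v t)

    step-weights : ∀ t → suc t ≤ m → (w t ≡ b × w (suc t) ≡ suc b) ⊎ (w t ≡ suc b × w (suc t) ≡ b)
    step-weights t st≤m with proj₁ (step t st≤m)
    ... | inj₁ e = let (inA , inB , _) = Subgraph.edg-in-G G' e in inj₁ (inA , inB)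
    ... | inj₂ e = let (inA , inB , _) = Subgraph.edg-in-G G' e in inj₂ (inB , inA)

    even-steps-same-weight : ∀ k t → k + k + t ≤ m → w (k + k + t) ≡ w t
    even-steps-same-weight zero t _ = refl
    even-steps-same-weight (suc k) t le rewrite ℕP.+-suc k k =
      trans (two-steps (k + k + t) le) (even-steps-same-weight k t (ℕP.≤-trans (ℕP.n≤1+n _) (ℕP.≤-trans (ℕP.n≤1+n _) le)))
      where
      two-steps : ∀ s → suc (suc s) ≤ m → w (suc (suc s)) ≡ w s
      two-steps s le with step-weights s (ℕP.<⇒≤ le) | step-weights (suc s) le
      ... | inj₁ (ws , _) | inj₂ (_ , wss) = trans wss (sym ws)
      ... | inj₂ (ws , _) | inj₁ (_ , wss) = trans wss (sym ws)
      ... | inj₁ (_ , w₁) | inj₁ (w₁′ , _) = contradiction (trans (sym w₁′) w₁) (ℕP.1+n≢n ∘ sym)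
      ... | inj₂ (_ , w₁) | inj₂ (w₁′ , _) = contradiction (trans (sym w₁) w₁′) (ℕP.1+n≢n ∘ sym)

    start-bit : ∀ t → suc t ≤ m →
      (w t ≡ b × lookup (v t) (c (suc t)) ≡ false) ⊎ (w t ≡ suc b × lookup (v t) (c (suc t)) ≡ true)
    start-bit t st≤m with flip-weight (v t) (v (suc t)) (c (suc t)) (proj₂ (step t st≤m)) | step-weights t st≤m
    ... | inj₁ (bit , _) | inj₁ (wt , _) = inj₁ (wt , bit)
    ... | inj₂ (bit , _) | inj₂ (wt , _) = inj₂ (wt , bit)
    ... | inj₁ (_ , up) | inj₂ (wt , wst) = contradiction (trans (sym wst) (trans up (cong suc wt))) (ℕP.m≢1+n+m b)
    ... | inj₂ (_ , down) | inj₁ (wt , wst) = contradiction (trans (sym wt) (trans down (cong suc wst))) (ℕP.m≢1+n+m b)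

    same-side-same-bit : ∀ s t → suc s ≤ m → suc t ≤ m → w s ≡ w t →
      lookup (v s) (c (suc s)) ≡ lookup (v t) (c (suc t))
    same-side-same-bit s t ss≤m st≤m ws≡wt with start-bit s ss≤m | start-bit t st≤m
    ... | inj₁ (_ , bs) | inj₁ (_ , bt) = trans bs (sym bt)
    ... | inj₂ (_ , bs) | inj₂ (_ , bt) = trans bs (sym bt)
    ... | inj₁ (ws , _) | inj₂ (wt , _) = contradiction (trans (sym ws) (trans ws≡wt wt)) (ℕP.1+n≢n ∘ sym)
    ... | inj₂ (ws , _) | inj₁ (wt , _) = contradiction (trans (sym wt) (trans (sym ws≡wt) ws)) (ℕP.1+n≢n ∘ sym)

    coordinate-constant : ∀ j a e → a ≤ e → e ≤ m → (∀ u → a < u → u ≤ e → c u ≢ j) →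
      lookup (v a) j ≡ lookup (v e) j
    coordinate-constant j a e a≤e e≤m unflipped with ℕP.m≤n⇒m<n∨m≡n a≤e
    ... | inj₂ refl = refl
    coordinate-constant j a zero _ _ _ | inj₁ ()
    coordinate-constant j a (suc e) _ se≤m unflipped | inj₁ a<se =
      trans (coordinate-constant j a e (ℕP.≤-pred a<se) (ℕP.<⇒≤ se≤m)
                                 (λ u a<u u≤e → unflipped u a<u (ℕP.m≤n⇒m≤1+n u≤e)))
            (proj₁ (proj₂ (step e se≤m)) j (λ j≡ → unflipped (suc e) a<se ℕP.≤-refl (sym j≡)))

    -- If the colour of edge p next recurs at edge q, then q − p is odd:
    -- otherwise both edges start on the same side and so flip that
    -- coordinate in the same direction, although it is not flipped between.
    even-recurrence-impossible : ∀ p q k → 1 ≤ p → p < q → q ≤ m → q ≡ k + k + p → c q ≡ c p →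
      (∀ u → p < u → u < q → c u ≢ c p) → ⊥
    even-recurrence-impossible (suc p0) (suc q0) k _ p<q q≤m gap same unflipped = flipped (begin
        lookup (v p0) j             ≡⟨ same-side-same-bit p0 q0 sp≤m q≤m (sym same-side) ⟩
        lookup (v q0) (c (suc q0))  ≡⟨ cong (lookup (v q0)) same ⟩
        lookup (v q0) j             ≡⟨ sym (coordinate-constant j (suc p0) q0 (ℕP.≤-pred p<q) (ℕP.<⇒≤ q≤m)
                                             (λ u p<u u≤q0 → unflipped u p<u (s≤s u≤q0))) ⟩
        lookup (v (suc p0)) j       ∎)
      where
      open ≡-Reasoning
      j : Fin d
      j = c (suc p0)
      sp≤m : suc p0 ≤ m
      sp≤m = ℕP.<⇒≤ (ℕP.<-≤-trans p<q q≤m)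
      flipped : lookup (v p0) j ≢ lookup (v (suc p0)) j
      flipped = proj₂ (proj₂ (step p0 sp≤m))
      q0≡ : q0 ≡ k + k + p0
      q0≡ = ℕP.suc-injective (trans gap (ℕP.+-suc (k + k) p0))
      same-side : w q0 ≡ w p0
      same-side = trans (cong w q0≡) (even-steps-same-weight k p0 (subst (_≤ m) q0≡ (ℕP.<⇒≤ q≤m)))

  -- The height function

  module _ {d : ℕ} where

    hstep-±1 : (a b : Fin d) → hstep a b ≡ 1ℤ ⊎ hstep a b ≡ -1ℤ
    hstep-±1 a b with a Fin.<? b
    ... | yes _ = inj₁ refl
    ... | no _ = inj₂ refl

    hstep-antisym : (a b : Fin d) → a ≢ b → hstep b a ≡ ℤ.- hstep a b
    hstep-antisym a b a≢b with a Fin.<? b | b Fin.<? a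
    ... | yes a<b | yes b<a = contradiction b<a (FinP.<-asym a<b)
    ... | yes _ | no _ = refl
    ... | no _ | yes _ = refl
    ... | no a≮b | no b≮a with FinP.<-cmp a b
    ...   | tri< a<b _ _ = contradiction a<b a≮b
    ...   | tri≈ _ a≡b _ = contradiction a≡b a≢b
    ...   | tri> _ _ b<a = contradiction b<a b≮a

    height-suc : (c : ℕ → Fin d) → ∀ x → 1 ≤ x → height c (suc x) ≡ height c x ℤ.+ hstep (c x) (c (suc x))
    height-suc c (suc x) _ = refl

    height-shift : (c : ℕ → Fin d) → ∀ r0 j →
      height (λ i → c (i + r0)) (suc j) ≡ height c (suc j + r0) - height c (suc r0)
    height-shift c r0 zero = sym (ℤP.+-inverseʳ (height c (suc r0)))
    height-shift c r0 (suc j) =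
      trans (cong (ℤ._+ hstep (c (suc j + r0)) (c (suc (suc j) + r0))) (height-shift c r0 j))
            (rearrange (height c (suc j + r0)) (height c (suc r0)) _)
      where
      rearrange : ∀ x y s → (x - y) ℤ.+ s ≡ (x ℤ.+ s) - y
      rearrange = solve-∀

    -- Each step changes the height by ±1, so h(n+1) ≡ n modulo 2: precisely,
    -- h(n+1) + 2k = n where k is the number of downward steps.
    height-parity : (c : ℕ → Fin d) → ∀ n → ∃[ k ] (height c (suc n) ℤ.+ ℤ.+ k ℤ.+ ℤ.+ k ≡ ℤ.+ n)
    height-parity c zero = 0 , refl
    height-parity c (suc n) with height-parity c n | hstep-±1 (c (suc n)) (c (suc (suc n)))
    ... | k , eq | inj₁ up rewrite up = k , trans (up-step (height c (suc n)) (ℤ.+ k)) (cong (λ z → 1ℤ ℤ.+ z) eq)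
      where
      up-step : ∀ h K → h ℤ.+ 1ℤ ℤ.+ K ℤ.+ K ≡ 1ℤ ℤ.+ (h ℤ.+ K ℤ.+ K)
      up-step = solve-∀
    ... | k , eq | inj₂ down rewrite down = suc k , trans (down-step (height c (suc n)) (ℤ.+ k)) (cong (λ z → 1ℤ ℤ.+ z) eq)
      where
      down-step : ∀ h K → h ℤ.+ -1ℤ ℤ.+ (1ℤ ℤ.+ K) ℤ.+ (1ℤ ℤ.+ K) ≡ 1ℤ ℤ.+ (h ℤ.+ K ℤ.+ K)
      down-step = solve-∀

    equal-heights-even-gap : (c : ℕ → Fin d) → ∀ p q → 1 ≤ p → p ≤ q → height c q ≡ height c p →
      ∃[ k ] q ≡ k + k + p
    equal-heights-even-gap c (suc p0) q _ p≤q level = k , (begin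
        q               ≡⟨ sym q≡ ⟩
        n + suc p0      ≡⟨ cong (_+ suc p0) n≡k+k ⟩
        k + k + suc p0  ∎)
      where
      open ≡-Reasoning
      n : ℕ
      n = q ∸ suc p0
      q≡ : n + suc p0 ≡ q
      q≡ = ℕP.m∸n+n≡m p≤q
      level-segment : height (λ i → c (i + p0)) (suc n) ≡ 0ℤ
      level-segment = trans (height-shift c p0 n)
        (trans (cong (λ h → h - height c (suc p0)) (trans (cong (height c) (trans (sym (ℕP.+-suc n p0)) q≡)) level))
               (ℤP.+-inverseʳ (height c (suc p0))))
      parity : ∃[ k ] (height (λ i → c (i + p0)) (suc n) ℤ.+ ℤ.+ k ℤ.+ ℤ.+ k ≡ ℤ.+ n)
      parity = height-parity (λ i → c (i + p0)) n
      k : ℕ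
      k = proj₁ parity
      n≡k+k : n ≡ k + k
      n≡k+k = sym (ℤP.+-injective (subst (λ h → h ℤ.+ ℤ.+ k ℤ.+ ℤ.+ k ≡ ℤ.+ n) level-segment (proj₂ parity)))

    -- The reversed walk has the reversed colour sequence; since consecutive
    -- colours differ, its heights are those of the original walk read
    -- backwards, relative to h(m).
    height-reverse : (c : ℕ → Fin d) → ∀ m → (∀ x → 1 ≤ x → suc x ≤ m → c x ≢ c (suc x)) →
      ∀ t → 1 ≤ t → t ≤ m → height (λ i → c (suc m ∸ i)) t ≡ height c (suc m ∸ t) - height c m
    height-reverse c m differ (suc zero) _ _ = sym (ℤP.+-inverseʳ (height c m))
    height-reverse c m differ (suc (suc j)) _ ssj≤m = begin
        height c′ (suc j) ℤ.+ hstep (c (m ∸ j)) (c x)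
          ≡⟨ cong₂ ℤ._+_ (height-reverse c m differ (suc j) (s≤s z≤n) sj≤m) (cong (λ y → hstep (c y) (c x)) m∸j≡) ⟩
        (height c (m ∸ j) - height c m) ℤ.+ hstep (c (suc x)) (c x)
          ≡⟨ cong₂ (λ h s → (h - height c m) ℤ.+ s) (trans (cong (height c) m∸j≡) (height-suc c x 1≤x)) backwards ⟩
        (height c x ℤ.+ s - height c m) ℤ.+ ℤ.- s
          ≡⟨ cancel (height c x) (height c m) s ⟩
        height c x - height c m ∎
      where
      open ≡-Reasoning
      c′ : ℕ → Fin d
      c′ i = c (suc m ∸ i)
      sj≤m : suc j ≤ m
      sj≤m = ℕP.<⇒≤ ssj≤m
      x : ℕ
      x = m ∸ suc j
      s : ℤ
      s = hstep (c x) (c (suc x))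
      1≤x : 1 ≤ x
      1≤x = ℕP.m<n⇒0<n∸m ssj≤m
      m∸j≡ : m ∸ j ≡ suc x
      m∸j≡ = ℕP.+-∸-assoc 1 sj≤m
      backwards : hstep (c (suc x)) (c x) ≡ ℤ.- s
      backwards = hstep-antisym (c x) (c (suc x)) (differ x 1≤x (subst (_≤ m) m∸j≡ (ℕP.m∸n≤m m j)))
      cancel : ∀ h H s → (h ℤ.+ s - H) ℤ.+ ℤ.- s ≡ h - H
      cancel = solve-∀

  module _ {d} {G' : Subgraph d} {m} {v : ℕ → Vert d} {c : ℕ → Fin d} (W : IsWalk G' m v c) where
    open IsWalk W

    segment : ∀ r0 L → L + r0 ≤ m → IsWalk G' L (λ i → v (i + r0)) (λ i → c (i + r0))
    segment r0 L L+r0≤m = record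
      { step    = λ i si≤L → step (i + r0) (within si≤L)
      ; nonback = λ i ssi≤L → nonback (i + r0) (within ssi≤L)
      }
      where
      within : ∀ {i} → i ≤ L → i + r0 ≤ m
      within i≤L = ℕP.≤-trans (ℕP.+-monoˡ-≤ r0 i≤L) L+r0≤m

    reverse : IsWalk G' m (λ i → v (m ∸ i)) (λ i → c (suc m ∸ i))
    reverse = record { step = reverse-step ; nonback = reverse-nonback }
      where
      pred-step : ∀ {i} → suc i ≤ m → m ∸ i ≡ suc (m ∸ suc i)
      pred-step = ℕP.+-∸-assoc 1

      reverse-step : ∀ i → suc i ≤ m →
        Adj G' (v (m ∸ i)) (v (m ∸ suc i)) × DiffAt (v (m ∸ i)) (v (m ∸ suc i)) (c (m ∸ i))
      reverse-step i si≤m rewrite pred-step si≤m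
        with step (m ∸ suc i) (subst (_≤ m) (pred-step si≤m) (ℕP.m∸n≤m m i))
      ... | adj , diff = swap adj , DiffAt-sym {x = v (m ∸ suc i)} {y = v (suc (m ∸ suc i))} diff

      reverse-nonback : ∀ i → suc (suc i) ≤ m → v (m ∸ i) ≢ v (m ∸ suc (suc i))
      reverse-nonback i ssi≤m eq =
        nonback (m ∸ suc (suc i)) (subst (_≤ m) m∸i≡ (ℕP.m∸n≤m m i)) (sym (trans (cong v (sym m∸i≡)) eq))
        where
        m∸i≡ : m ∸ i ≡ suc (suc (m ∸ suc (suc i)))
        m∸i≡ = trans (pred-step (ℕP.<⇒≤ ssi≤m)) (cong suc (pred-step ssi≤m))

  -- Short walks in a k-flat subgraph

  module _ {d} (k : ℕ) (G' : Subgraph d) (flat : Flat k G') where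

    -- If after edge r0+1 up to edge q all heights lie strictly below
    -- h(r0+1), then the segment from edge r0+1 to edge q is a walk whose
    -- heights stay below its start, so flatness gives c(q) < c(r0+1).
    peak-before : ∀ {m v c} → IsWalk G' m v c → m ≤ 2 * k + 1 → ∀ r0 q → suc r0 < q → q ≤ m →
      (∀ i → suc r0 < i → i ≤ q → height c i ℤ.< height c (suc r0)) → c q Fin.< c (suc r0)
    peak-before {m} {v} {c} W short r0 q r<q q≤m below =
      subst (λ i → c i Fin.< c (suc r0)) L+r0≡q
        (flat L (λ i → v (i + r0)) (λ i → c (i + r0)) (segment W r0 L (subst (_≤ m) (sym L+r0≡q) q≤m))
              2≤L below-start (inj₁ (ℕP.≤-trans (ℕP.m∸n≤m q r0) (ℕP.≤-trans q≤m short))))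
      where
      L : ℕ
      L = q ∸ r0
      L+r0≡q : L + r0 ≡ q
      L+r0≡q = ℕP.m∸n+n≡m (ℕP.≤-trans (ℕP.n≤1+n r0) (ℕP.<⇒≤ r<q))
      2≤L : 2 ≤ L
      2≤L = subst (_≤ L) (ℕP.m+n∸n≡m 2 r0) (ℕP.∸-monoˡ-≤ r0 r<q)
      below-start : ∀ i → 2 ≤ i → i ≤ L → height (λ i → c (i + r0)) i ℤ.< 0ℤ
      below-start (suc j) (s≤s 1≤j) i≤L =
        subst (ℤ._< 0ℤ) (sym (height-shift c r0 j))
          (subst (λ z → height c (suc j + r0) - height c (suc r0) ℤ.< z) (ℤP.+-inverseʳ (height c (suc r0)))
            (ℤP.+-monoˡ-< (ℤ.- height c (suc r0))
              (below (suc j + r0) (s≤s (ℕP.+-monoˡ-≤ r0 1≤j)) (subst (suc j + r0 ≤_) L+r0≡q (ℕP.+-monoˡ-≤ r0 i≤L)))))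

    -- Descent: if the height drops from edge p to edge q, some edge in
    -- [p, q) has a larger colour than edge q; it is found at the last
    -- maximum of the height on [p, q].
    descent : ∀ {m v c} → IsWalk G' m v c → m ≤ 2 * k + 1 → ∀ p q → 1 ≤ p → p < q → q ≤ m →
      height c q ℤ.< height c p → ∃[ r ] (p ≤ r × r < q × c q Fin.< c r)
    descent {c = c} W short p q 1≤p p<q q≤m drop
      with last-argmax ℤP.<-isStrictTotalOrder (height c) p q (ℕP.<⇒≤ p<q)
    ... | r , p≤r , r≤q , not-above , below = r , p≤r , r<q , larger r (ℕP.≤-trans 1≤p p≤r) r<q below
      where
      r<q : r < q
      r<q = ℕP.≤∧≢⇒< r≤q λ { refl → not-above p ℕP.≤-refl (ℕP.<⇒≤ p<q) drop }
      larger : ∀ r → 1 ≤ r → r < q → (∀ i → r < i → i ≤ q → height c i ℤ.< height c r) → c q Fin.< c r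
      larger (suc r0) _ r<q below = peak-before W short r0 q r<q q≤m below

    -- Ascent: if the height rises from edge p to edge q, some edge in
    -- (p, q] has a larger colour than edge p (descent on the reversed walk).
    ascent : ∀ {m v c} → IsWalk G' m v c → m ≤ 2 * k + 1 → ∀ p q → 1 ≤ p → p < q → q ≤ m →
      height c p ℤ.< height c q → ∃[ r ] (p < r × r ≤ q × c p Fin.< c r)
    ascent {m} {v} {c} W short p q 1≤p p<q q≤m rise =
      mirror-back (descent (reverse W) short (suc m ∸ q) (suc m ∸ p) 1≤p′ p′<q′ q′≤m drop)
      where
      p≤sm : p ≤ suc m
      p≤sm = ℕP.m≤n⇒m≤1+n (ℕP.≤-trans (ℕP.<⇒≤ p<q) q≤m)
      q≤sm : q ≤ suc m
      q≤sm = ℕP.m≤n⇒m≤1+n q≤m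
      1≤p′ : 1 ≤ suc m ∸ q
      1≤p′ = ℕP.m<n⇒0<n∸m (s≤s q≤m)
      p′<q′ : suc m ∸ q < suc m ∸ p
      p′<q′ = ℕP.∸-monoʳ-< p<q q≤sm
      q′≤m : suc m ∸ p ≤ m
      q′≤m = ℕP.∸-monoʳ-≤ (suc m) 1≤p
      mirrored : ∀ t → t ≤ suc m → 1 ≤ suc m ∸ t → suc m ∸ t ≤ m →
        height (λ i → c (suc m ∸ i)) (suc m ∸ t) ≡ height c t - height c m
      mirrored t t≤sm 1≤t′ t′≤m =
        trans (height-reverse c m (WalkInCube.colours-differ W) (suc m ∸ t) 1≤t′ t′≤m)
              (cong (λ i → height c i - height c m) (ℕP.m∸[m∸n]≡n t≤sm))
      drop : height (λ i → c (suc m ∸ i)) (suc m ∸ p) ℤ.< height (λ i → c (suc m ∸ i)) (suc m ∸ q)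
      drop = subst₂ ℤ._<_
        (sym (mirrored p p≤sm (ℕP.≤-trans 1≤p′ (ℕP.<⇒≤ p′<q′)) q′≤m))
        (sym (mirrored q q≤sm 1≤p′ (ℕP.≤-trans (ℕP.<⇒≤ p′<q′) q′≤m)))
        (ℤP.+-monoˡ-< (ℤ.- height c m) rise)
      mirror-back : ∃[ r′ ] (suc m ∸ q ≤ r′ × r′ < suc m ∸ p × c (suc m ∸ (suc m ∸ p)) Fin.< c (suc m ∸ r′)) →
        ∃[ r ] (p < r × r ≤ q × c p Fin.< c r)
      mirror-back (r′ , p′≤r′ , r′<q′ , larger) =
        suc m ∸ r′ , reflect-< p≤sm r′<q′ , reflect-≤ q≤sm p′≤r′ ,
        subst (λ i → c i Fin.< c (suc m ∸ r′)) (ℕP.m∸[m∸n]≡n p≤sm) larger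

    -- A largest colour cannot recur at its next occurrence: comparing the
    -- heights at the two occurrences p < q, descent or ascent would produce
    -- a larger colour, and equal heights would give an even recurrence.
    largest-colour-no-recurrence : ∀ {m v c} → IsWalk G' m v c → m ≤ 2 * k + 1 →
      ∀ p q → 1 ≤ p → p < q → q ≤ m → c q ≡ c p → (∀ u → p < u → u < q → c u ≢ c p) →
      (∀ t → 1 ≤ t → t ≤ m → ¬ (c p Fin.< c t)) → ⊥
    largest-colour-no-recurrence {c = c} W short p q 1≤p p<q q≤m same unused largest
      with ℤP.<-cmp (height c q) (height c p)
    ... | tri< drop _ _ with descent W short p q 1≤p p<q q≤m drop
    ...   | r , p≤r , r<q , larger =
            largest r (ℕP.≤-trans 1≤p p≤r) (ℕP.<⇒≤ (ℕP.<-≤-trans r<q q≤m)) (subst (Fin._< c r) same larger)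
    largest-colour-no-recurrence {c = c} W short p q 1≤p p<q q≤m same unused largest
      | tri≈ _ level _ with equal-heights-even-gap c p q 1≤p (ℕP.<⇒≤ p<q) level
    ...   | k′ , gap = WalkInCube.even-recurrence-impossible W p q k′ 1≤p p<q q≤m gap same unused
    largest-colour-no-recurrence {c = c} W short p q 1≤p p<q q≤m same unused largest
      | tri> _ _ rise with ascent W short p q 1≤p p<q q≤m rise
    ...   | r , p<r , r≤q , larger =
            largest r (ℕP.≤-trans 1≤p (ℕP.<⇒≤ p<r)) (ℕP.≤-trans r≤q q≤m) larger

    -- Hence a largest colour of a short walk occurs only once: any repeat
    -- p < q yields a next occurrence after p.
    largest-colour-unrepeated : ∀ {m v c} → IsWalk G' m v c → m ≤ 2 * k + 1 →
      ∀ p q → 1 ≤ p → p < q → q ≤ m → c q ≡ c p →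
      (∀ t → 1 ≤ t → t ≤ m → ¬ (c p Fin.< c t)) → ⊥
    largest-colour-unrepeated {c = c} W short p q 1≤p p<q q≤m same largest
      with least-witness (λ u → (p ℕP.<? u) ×-dec (c u Fin.≟ c p)) (p<q , same)
    ... | q₁ , (p<q₁ , same₁) , q₁≤q , earlier =
      largest-colour-no-recurrence W short p q₁ 1≤p p<q₁ (ℕP.≤-trans q₁≤q q≤m) same₁
        (λ u p<u u<q₁ same-u → earlier u u<q₁ (p<u , same-u)) largest

open import Defs
open import Data.Nat using (ℕ; _≤_; _*_; _+_)
open import Data.Fin using (Fin; _<_)
open import Data.Bool using (Bool)
open import Data.Vec using (Vec)
open import Data.Product using (_×_; ∃-syntax; _,_)
open import Relation.Binary.PropositionalEquality using (_≢_; sym; subst)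
import Data.Nat.Properties as ℕP
import Data.Fin.Properties as FinP
open import Function using (_∘_)
open import Data.Empty using (⊥-elim)
open import Relation.Nullary using (contradiction)
open import Relation.Binary using (tri<; tri≈; tri>)
open FlatWalks using (last-argmax; largest-colour-unrepeated)

-- The last position i of a largest colour is the required edge: later
-- edges have smaller colours by the choice of i, and no earlier edge
-- repeats its colour.
lemma15 : (d k : ℕ) → 1 ≤ d → 1 ≤ k → (G' : Subgraph d) → Flat k G' →
    (m : ℕ) (v : ℕ → Vec Bool d) (c : ℕ → Fin d) → IsWalk G' m v c →
    1 ≤ m → m ≤ 2 * k + 1 →
    ∃[ i ] (1 ≤ i × i ≤ m × (∀ j → 1 ≤ j → j ≤ m → j ≢ i → c j < c i))
lemma15 _ k _ _ G' flat m _ c W 1≤m short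
  with last-argmax FinP.<-isStrictTotalOrder c 1 m 1≤m
... | i , 1≤i , i≤m , not-above , below = i , 1≤i , i≤m , smaller
  where
  smaller : ∀ j → 1 ≤ j → j ≤ m → j ≢ i → c j < c i
  smaller j 1≤j j≤m j≢i with FinP.<-cmp (c j) (c i)
  ... | tri< cj<ci _ _ = cj<ci
  ... | tri> _ _ ci<cj = contradiction ci<cj (not-above j 1≤j j≤m)
  ... | tri≈ _ same _ with ℕP.<-cmp j i
  ...   | tri< j<i _ _ = ⊥-elim (
          largest-colour-unrepeated k G' flat W short j i 1≤j j<i i≤m (sym same)
            (λ t 1≤t t≤m → not-above t 1≤t t≤m ∘ subst (_< c t) same))
  ...   | tri≈ _ j≡i _ = contradiction j≡i j≢i
  ...   | tri> _ _ i<j = contradiction same (FinP.<⇒≢ (below j i<j j≤m))
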